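{- Let $q\ge 3$ be an odd integer. For every $p\ge 1$ the graph $G_{q,p}$ is $qK_2$-free, i.e., it contains no induced matching with $q$ edges.
   Context: All graphs are finite and simple. $qK_2$ denotes the disjoint union of $q$ edges; an induced matching is a set of pairwise disjoint edges no two of which are joined by an edge. For odd $q\ge 3$ and $p\ge 1$, $G_{q,p}$ is the graph with vertex set $\{0,1,\dots,qp-3\}$, where arithmetic on vertices is modulo $qp-2$, in which the neighborhood of each vertex $i$ is $N(i)=\{i-1,i+1\}\cup\{i+qj-1 : j\in\{1,\dots,p-1\}\}$. -}

module Defs where

open import Data.Nat using (ℕ; suc; _+_; _*_; _∸_; _≤_; _%_; NonZero)
open import Data.Fin using (Fin; toℕ)
open import Data.Product using (Σ; _×_; ∃-syntax; proj₁; proj₂)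
open import Data.Sum using (_⊎_)
open import Relation.Binary.PropositionalEquality using (_≡_; _≢_)
open import Relation.Nullary using (¬_)

order : ℕ → ℕ → ℕ
order q p = q * p ∸ 2

-- InNbhd n q p i j : "j ∈ N(i)" in G_{q,p}, with n = qp - 2 and all
-- arithmetic on vertices modulo n:
--   N(i) = {i-1, i+1} ∪ {i + q k - 1 : k ∈ {1,…,p-1}}.
-- Since the graph is simple, loops are excluded (i ≠ j).
InNbhd : (n q p : ℕ) .{{_ : NonZero n}} → Fin n → Fin n → Set
InNbhd n q p i j =
  i ≢ j ×
  ( (toℕ j ≡ (toℕ i + 1) % n)
  ⊎ (toℕ j ≡ (toℕ i + (n ∸ 1)) % n)
  ⊎ (∃[ k ] (1 ≤ k × k ≤ p ∸ 1 × toℕ j ≡ (toℕ i + q * k ∸ 1) % n)))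

GraphG : (q p : ℕ) .{{_ : NonZero (order q p)}} → Fin (order q p) → Fin (order q p) → Set
GraphG q p = InNbhd (order q p) q p

Graph : ℕ → Set₁
Graph n = Fin n → Fin n → Set

-- An induced matching with m edges in G: m pairs (a t , b t) such that
-- each pair is an edge, the 2m endpoints are pairwise distinct, and
-- no edge of G joins endpoints of two different pairs.
-- (Adjacency is tested in both directions, so this is correct for any
-- possibly non-symmetric presentation of G.)
Adj : {n : ℕ} → Graph n → Fin n → Fin n → Set
Adj G u v = G u v ⊎ G v u

IsInducedMatching : {n : ℕ} → Graph n → (m : ℕ) → (Fin m → Fin n × Fin n) → Set
IsInducedMatching G m e =
  (∀ t → Adj G (proj₁ (e t)) (proj₂ (e t))) ×
  (∀ t → proj₁ (e t) ≢ proj₂ (e t)) ×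
  (∀ s t → s ≢ t →
      proj₁ (e s) ≢ proj₁ (e t) × proj₁ (e s) ≢ proj₂ (e t) ×
      proj₂ (e s) ≢ proj₁ (e t) × proj₂ (e s) ≢ proj₂ (e t) ×
      ¬ Adj G (proj₁ (e s)) (proj₁ (e t)) × ¬ Adj G (proj₁ (e s)) (proj₂ (e t)) ×
      ¬ Adj G (proj₂ (e s)) (proj₁ (e t)) × ¬ Adj G (proj₂ (e s)) (proj₂ (e t)))

HasInducedMatching : {n : ℕ} → Graph n → ℕ → Set
HasInducedMatching {n} G m = Σ (Fin m → Fin n × Fin n) (IsInducedMatching G m)

-- Let q = 2s + 1, n = qp − 2 and c = sp − 1, so that n = 2c + p and c + p is the inverse of q
-- modulo n. Relabelling vertex i as i (c + p) mod n turns the neighbours i − 1, i + 1 and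
-- i + qk − 1 of i into the points at offset c + k (0 ≤ k ≤ p) from its label: two vertices are
-- adjacent iff both arcs of the n-cycle between their labels have length at least c. An induced
-- qK₂ thus becomes q pairs of far points, any two points of different pairs being near.
-- A window (arc) of length c contains at most one point of each pair, and the window of length c
-- starting at a point meets every pair. Sliding a window one step loses at most the point it
-- leaves, so walking around the cycle from a point, every window of length c contains at least
-- q − 1 points. The cycle splits into windows of lengths p, c and c, hence every window of
-- length p contains at most 2 of the 2q points. But the q windows of length p starting at
-- x₀ + kp cover qp = n + 2 positions, so they cover every point and x₀ twice: together they
-- contain at least 2q + 1 points, more than the 2q they can hold.
module Submission where

open import Defs
open import Data.Nat using (ℕ; _≤_; _%_; NonZero)
open import Relation.Binary.PropositionalEquality using (_≡_)
open import Relation.Nullary using (¬_)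

open import Level using (0ℓ)
open import Data.Nat hiding (_≤_; _%_; NonZero)
open import Data.Nat.Properties
open import Data.Nat.DivMod
open import Data.Bool using (Bool; true; false)
open import Data.Fin using (Fin; zero; suc; toℕ; fromℕ<; punchIn; punchOut)
import Data.Fin.Properties as Fin
open import Data.Product using (∃-syntax; _×_; _,_; proj₁; proj₂; swap)
open import Data.Sum using (_⊎_; inj₁; inj₂)
open import Function using (_∘_)
open import Relation.Binary using (Setoid)
import Relation.Binary.Construct.On as On
import Relation.Binary.Reasoning.Setoid as SetoidReasoning
open import Relation.Binary.PropositionalEquality
  using (_≢_; refl; sym; trans; cong; cong₂; subst; subst₂; module ≡-Reasoning)
  renaming (setoid to ≡-setoid)
open import Relation.Nullary using (Dec; yes; no; contradiction)
open import Relation.Nullary.Decidable using (_⊎-dec_)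
open import Algebra.Properties.CommutativeMonoid.Sum +-0-commutativeMonoid
  using (sum; sum-syntax; sum-cong-≗; ∑-distrib-+; ∑-comm; sum-remove)
open import Algebra.Properties.CommutativeSemigroup +-commutativeSemigroup
  using (interchange; x∙yz≈y∙xz; xy∙z≈xz∙y)
open import Algebra.Properties.CommutativeSemigroup *-commutativeSemigroup
  using () renaming (x∙yz≈y∙xz to x*[y*z]≡y*[x*z])
open import Data.Nat.Tactic.RingSolver using (solve-∀)

private variable
  a a′ b k t x x′ y y′ : ℕ

𝟙[_<_] : ℕ → ℕ → ℕ
𝟙[ a < b ] with a <? b
... | yes _ = 1
... | no  _ = 0

𝟙-yes : a < b → 𝟙[ a < b ] ≡ 1
𝟙-yes {a} {b} a<b with a <? b
... | yes _   = refl
... | no  a≮b = contradiction a<b a≮b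

𝟙-no : b ≤ a → 𝟙[ a < b ] ≡ 0
𝟙-no {b} {a} b≤a with a <? b
... | yes a<b = contradiction b≤a (<⇒≱ a<b)
... | no  _   = refl

𝟙≤1 : ∀ a b → 𝟙[ a < b ] ≤ 1
𝟙≤1 a b with a <? b
... | yes _ = ≤-refl
... | no  _ = z≤n

𝟙-antitone : a ≤ a′ → 𝟙[ a′ < b ] ≤ 𝟙[ a < b ]
𝟙-antitone {a} {a′} {b} a≤a′ with a′ <? b
... | no  _    = z≤n
... | yes a′<b = ≤-reflexive (sym (𝟙-yes (≤-<-trans a≤a′ a′<b)))

𝟙-pair≤1 : ∀ {a b c} → ¬ (a < c × b < c) → 𝟙[ a < c ] + 𝟙[ b < c ] ≤ 1
𝟙-pair≤1 {a} {b} {c} ¬both with c ≤? a | c ≤? b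
... | yes c≤a | _       = subst (_≤ 1) (cong (_+ 𝟙[ b < c ]) (sym (𝟙-no c≤a))) (𝟙≤1 b c)
... | no  _   | yes c≤b = subst (_≤ 1) (trans (sym (+-identityʳ _)) (cong (𝟙[ a < c ] +_) (sym (𝟙-no c≤b))))
                                (𝟙≤1 a c)
... | no  c≰a | no  c≰b = contradiction (≰⇒> c≰a , ≰⇒> c≰b) ¬both

∑-mono-≤ : ∀ {m} {f g : Fin m → ℕ} → (∀ i → f i ≤ g i) → ∑[ i < m ] f i ≤ ∑[ i < m ] g i
∑-mono-≤ {zero}  f≤g = z≤n
∑-mono-≤ {suc m} f≤g = +-mono-≤ (f≤g zero) (∑-mono-≤ (f≤g ∘ suc))

∑-const : ∀ m k → ∑[ i < m ] k ≡ m * k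
∑-const zero    k = refl
∑-const (suc m) k = cong (k +_) (∑-const m k)

term≤∑ : ∀ {m} (f : Fin m → ℕ) i → f i ≤ ∑[ k < m ] f k
term≤∑ f zero    = m≤m+n _ _
term≤∑ f (suc i) = ≤-trans (term≤∑ (f ∘ suc) i) (m≤n+m _ _)

two-terms≤∑ : ∀ {m} (f : Fin m → ℕ) {i j} → i ≢ j → f i + f j ≤ ∑[ k < m ] f k
two-terms≤∑ {suc m} f {i} {j} i≢j = begin
  f i + f j                            ≡⟨ cong (λ k → f i + f k) (Fin.punchIn-punchOut i≢j) ⟨
  f i + f (punchIn i (punchOut i≢j))   ≤⟨ +-monoʳ-≤ (f i) (term≤∑ (f ∘ punchIn i) (punchOut i≢j)) ⟩
  f i + ∑[ k < m ] f (punchIn i k)     ≡⟨ sum-remove {i = i} f ⟨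
  ∑[ k < suc m ] f k                   ∎
  where open ≤-Reasoning

∑-mono-≤-except : ∀ {m e} {f g : Fin m → ℕ} i →
                  (∀ j → j ≢ i → f j ≤ g j) → f i ≤ e + g i →
                  ∑[ j < m ] f j ≤ e + ∑[ j < m ] g j
∑-mono-≤-except {suc m} {e} {f} {g} i f≤g fᵢ≤e+gᵢ = begin
  ∑[ j < suc m ] f j                       ≡⟨ sum-remove {i = i} f ⟩
  f i + ∑[ j < m ] f (punchIn i j)         ≤⟨ +-mono-≤ fᵢ≤e+gᵢ (∑-mono-≤ λ j → f≤g _ (Fin.punchInᵢ≢i i j)) ⟩
  e + g i + ∑[ j < m ] g (punchIn i j)     ≡⟨ +-assoc e (g i) _ ⟩
  e + (g i + ∑[ j < m ] g (punchIn i j))   ≡⟨ cong (e +_) (sum-remove {i = i} g) ⟨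
  e + ∑[ j < suc m ] g j                   ∎
  where open ≤-Reasoning

endpoint : ∀ {n m} → (Fin m → Fin n × Fin n) → Fin m → Bool → Fin n
endpoint e i true  = proj₁ (e i)
endpoint e i false = proj₂ (e i)

cross-pair : ∀ {n m} {G : Graph n} {e} → IsInducedMatching G m e → ∀ {s t} → s ≢ t → ∀ b b′ →
             endpoint e s b ≢ endpoint e t b′ × ¬ Adj G (endpoint e s b) (endpoint e t b′)
cross-pair (_ , _ , cross) s≢t true  true  with cross _ _ s≢t
... | d , _ , _ , _ , a , _         = d , a
cross-pair (_ , _ , cross) s≢t true  false with cross _ _ s≢t
... | _ , d , _ , _ , _ , a , _     = d , a
cross-pair (_ , _ , cross) s≢t false true  with cross _ _ s≢t
... | _ , _ , d , _ , _ , _ , a , _ = d , a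
cross-pair (_ , _ , cross) s≢t false false with cross _ _ s≢t
... | _ , _ , _ , d , _ , _ , _ , a = d , a

no-induced-matching-on-one-vertex : ∀ {G : Graph 1} {m} → ¬ HasInducedMatching G (suc m)
no-induced-matching-on-one-vertex (e , _ , endpoints-differ , _) with e zero | endpoints-differ zero
... | zero , zero | 0≢0 = 0≢0 refl

module Cyclic (n : ℕ) .{{_ : NonZero n}} where

  infix 4 _≋_
  _≋_ : ℕ → ℕ → Set
  x ≋ y = x % n ≡ y % n

  ≋-setoid : Setoid 0ℓ 0ℓ
  ≋-setoid = On.setoid (≡-setoid ℕ) (_% n)

  module ≋-Reasoning = SetoidReasoning ≋-setoid

  ≡⇒≋ : x ≡ y → x ≋ y
  ≡⇒≋ = cong (_% n)

  ≋⇒≡% : x < n → x ≋ y → x ≡ y % n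
  ≋⇒≡% x<n x≋y = trans (sym (m<n⇒m%n≡m x<n)) x≋y

  ≋⇒≡ : x < n → y < n → x ≋ y → x ≡ y
  ≋⇒≡ x<n y<n x≋y = trans (≋⇒≡% x<n x≋y) (m<n⇒m%n≡m y<n)

  ≡%⇒≋ : x ≡ y % n → x ≋ y
  ≡%⇒≋ {x} {y} x≡y%n = trans (cong (_% n) x≡y%n) (m%n%n≡m%n y n)

  %-≋ : ∀ x → x % n ≋ x
  %-≋ x = m%n%n≡m%n x n

  +n-≋ : ∀ x → x + n ≋ x
  +n-≋ x = [m+n]%n≡m%n x n

  +*n-≋ : ∀ x k → x + k * n ≋ x
  +*n-≋ x k = [m+kn]%n≡m%n x k n

  +-cong-≋ : x ≋ x′ → y ≋ y′ → x + y ≋ x′ + y′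
  +-cong-≋ {x} {x′} {y} {y′} x≋x′ y≋y′ = begin-equality
    (x + y) % n                  ≡⟨ %-distribˡ-+ x y n ⟩
    (x % n + y % n) % n          ≡⟨ cong₂ (λ u v → (u + v) % n) x≋x′ y≋y′ ⟩
    (x′ % n + y′ % n) % n        ≡⟨ %-distribˡ-+ x′ y′ n ⟨
    (x′ + y′) % n                ∎
    where open ≤-Reasoning

  +-congˡ-≋ : y ≋ y′ → x + y ≋ x + y′
  +-congˡ-≋ = +-cong-≋ refl

  +-congʳ-≋ : x ≋ x′ → x + y ≋ x′ + y
  +-congʳ-≋ x≋x′ = +-cong-≋ x≋x′ refl

  *-congˡ-≋ : ∀ x → y ≋ y′ → x * y ≋ x * y′
  *-congˡ-≋ {y} {y′} x y≋y′ = begin-equality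
    (x * y) % n                  ≡⟨ %-distribˡ-* x y n ⟩
    (x % n * (y % n)) % n        ≡⟨ cong (λ v → (x % n * v) % n) y≋y′ ⟩
    (x % n * (y′ % n)) % n       ≡⟨ %-distribˡ-* x y′ n ⟨
    (x * y′) % n                 ∎
    where open ≤-Reasoning

  *-congʳ-≋ : ∀ y → x ≋ x′ → x * y ≋ x′ * y
  *-congʳ-≋ {x} {x′} y x≋x′ =
    trans (≡⇒≋ (*-comm x y)) (trans (*-congˡ-≋ y x≋x′) (≡⇒≋ (*-comm y x′)))

  infix 8 -_
  -_ : ℕ → ℕ
  - x = n ∸ x % n

  +-inverseʳ-≋ : ∀ x → x + - x ≋ 0
  +-inverseʳ-≋ x = begin
    x + - x          ≈⟨ +-congʳ-≋ (%-≋ x) ⟨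
    x % n + - x      ≡⟨ m+[n∸m]≡n (m%n≤n x n) ⟩
    n                ≈⟨ +n-≋ 0 ⟩
    0                ∎
    where open ≋-Reasoning

  x-k+k≋x : ∀ x k → x + - k + k ≋ x
  x-k+k≋x x k = begin
    x + - k + k      ≡⟨ trans (+-assoc x (- k) k) (cong (x +_) (+-comm (- k) k)) ⟩
    x + (k + - k)    ≈⟨ +-congˡ-≋ (+-inverseʳ-≋ k) ⟩
    x + 0            ≡⟨ +-identityʳ x ⟩
    x                ∎
    where open ≋-Reasoning

  +-cancelʳ-≋ : ∀ x y z → x + z ≋ y + z → x ≋ y
  +-cancelʳ-≋ x y z x+z≋y+z = begin
    x                ≡⟨ +-identityʳ x ⟨
    x + 0            ≈⟨ +-congˡ-≋ (+-inverseʳ-≋ z) ⟨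
    x + (z + - z)    ≡⟨ +-assoc x z (- z) ⟨
    x + z + - z      ≈⟨ +-congʳ-≋ x+z≋y+z ⟩
    y + z + - z      ≡⟨ +-assoc y z (- z) ⟩
    y + (z + - z)    ≈⟨ +-congˡ-≋ (+-inverseʳ-≋ z) ⟩
    y + 0            ≡⟨ +-identityʳ y ⟩
    y                ∎
    where open ≋-Reasoning

  +-cancelˡ-≋ : ∀ z x y → z + x ≋ z + y → x ≋ y
  +-cancelˡ-≋ z x y z+x≋z+y =
    +-cancelʳ-≋ x y z (trans (≡⇒≋ (+-comm x z)) (trans z+x≋z+y (≡⇒≋ (+-comm z y))))

  +1≋⇒≡% : x < n → x + 1 ≋ y + 1 → x ≡ y % n
  +1≋⇒≡% {x} {y} x<n x+1≋y+1 = ≋⇒≡% x<n (+-cancelʳ-≋ x y 1 x+1≋y+1)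

  -- Distance along the cycle

  dist : ℕ → ℕ → ℕ
  dist x y = (y + - x) % n

  dist<n : ∀ x y → dist x y < n
  dist<n x y = m%n<n _ n

  +-dist-≋ : ∀ x y → x + dist x y ≋ y
  +-dist-≋ x y = begin
    x + dist x y     ≈⟨ +-congˡ-≋ (%-≋ (y + - x)) ⟩
    x + (y + - x)    ≡⟨ x∙yz≈y∙xz x y (- x) ⟩
    y + (x + - x)    ≈⟨ +-congˡ-≋ (+-inverseʳ-≋ x) ⟩
    y + 0            ≡⟨ +-identityʳ y ⟩
    y                ∎
    where open ≋-Reasoning

  dist-congˡ : x ≋ x′ → dist x y ≡ dist x′ y
  dist-congˡ {y = y} x≋x′ = cong (λ r → (y + (n ∸ r)) % n) x≋x′

  dist≡%n : x + k ≋ y → dist x y ≡ k % n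
  dist≡%n {x} {k} {y} x+k≋y = ≋⇒≡ (dist<n x y) (m%n<n k n) (+-cancelˡ-≋ x _ _ (begin
    x + dist x y     ≈⟨ +-dist-≋ x y ⟩
    y                ≈⟨ x+k≋y ⟨
    x + k            ≈⟨ +-congˡ-≋ (%-≋ k) ⟨
    x + k % n        ∎))
    where open ≋-Reasoning

  dist-unique : x + k ≋ y → k < n → dist x y ≡ k
  dist-unique x+k≋y k<n = trans (dist≡%n x+k≋y) (m<n⇒m%n≡m k<n)

  dist-≤ : x + k ≋ y → dist x y ≤ k
  dist-≤ {k = k} x+k≋y = subst (_≤ k) (sym (dist≡%n x+k≋y)) (m%n≤m k n)

  ≋⇒dist≡0 : x ≋ y → dist x y ≡ 0
  ≋⇒dist≡0 {x} x≋y = dist-unique (trans (≡⇒≋ (+-identityʳ x)) x≋y) (>-nonZero⁻¹ n)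

  dist≡0⇒≋ : dist x y ≡ 0 → x ≋ y
  dist≡0⇒≋ {x} {y} xy≡0 = begin
    x              ≡⟨ +-identityʳ x ⟨
    x + 0          ≡⟨ cong (x +_) xy≡0 ⟨
    x + dist x y   ≈⟨ +-dist-≋ x y ⟩
    y              ∎
    where open ≋-Reasoning

  dist-+ˡ : a ≤ dist x y → dist (x + a) y ≡ dist x y ∸ a
  dist-+ˡ {a} {x} {y} a≤xy = dist-unique (begin
    x + a + (dist x y ∸ a)   ≡⟨ trans (+-assoc x a _) (cong (x +_) (m+[n∸m]≡n a≤xy)) ⟩
    x + dist x y             ≈⟨ +-dist-≋ x y ⟩
    y                        ∎)
    (≤-<-trans (m∸n≤m _ a) (dist<n x y))
    where open ≋-Reasoning

  dist-+ˡ-wrap : dist x y < a → a ≤ n → dist (x + a) y ≡ dist x y + (n ∸ a)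
  dist-+ˡ-wrap {x} {y} {a} xy<a a≤n = dist-unique (begin
    x + a + (dist x y + (n ∸ a))   ≡⟨ interchange x a (dist x y) (n ∸ a) ⟩
    x + dist x y + (a + (n ∸ a))   ≡⟨ cong (x + dist x y +_) (m+[n∸m]≡n a≤n) ⟩
    x + dist x y + n               ≈⟨ +n-≋ _ ⟩
    x + dist x y                   ≈⟨ +-dist-≋ x y ⟩
    y                              ∎)
    (subst (dist x y + (n ∸ a) <_) (m+[n∸m]≡n a≤n) (+-monoˡ-< (n ∸ a) xy<a))
    where open ≋-Reasoning

  dist-suc-≤ : ¬ x ≋ y → dist (suc x) y ≤ dist x y
  dist-suc-≤ {x} {y} x≉y = begin
    dist (suc x) y   ≡⟨ dist-congˡ (≡⇒≋ (+-comm 1 x)) ⟩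
    dist (x + 1) y   ≡⟨ dist-+ˡ (n≢0⇒n>0 (x≉y ∘ dist≡0⇒≋)) ⟩
    dist x y ∸ 1     ≤⟨ m∸n≤m (dist x y) 1 ⟩
    dist x y         ∎
    where open ≤-Reasoning

  dist≤dist-from : dist t x ≤ dist t y → dist x y ≤ dist t y
  dist≤dist-from {t} {x} {y} tx≤ty = begin
    dist x y                ≡⟨ dist-congˡ (sym (+-dist-≋ t x)) ⟩
    dist (t + dist t x) y   ≡⟨ dist-+ˡ tx≤ty ⟩
    dist t y ∸ dist t x     ≤⟨ m∸n≤m (dist t y) (dist t x) ⟩
    dist t y                ∎
    where open ≤-Reasoning

  dist+dist≡n : ¬ x ≋ y → dist x y + dist y x ≡ n
  dist+dist≡n {x} {y} x≉y = trans (cong (dist x y +_) yx≡n∸xy) (m+[n∸m]≡n xy≤n)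
    where
    xy≤n = <⇒≤ (dist<n x y)
    yx≡n∸xy : dist y x ≡ n ∸ dist x y
    yx≡n∸xy = dist-unique (begin
      y + (n ∸ dist x y)              ≈⟨ +-congʳ-≋ (+-dist-≋ x y) ⟨
      x + dist x y + (n ∸ dist x y)   ≡⟨ trans (+-assoc x _ _) (cong (x +_) (m+[n∸m]≡n xy≤n)) ⟩
      x + n                           ≈⟨ +n-≋ x ⟩
      x                               ∎)
      (∸-monoʳ-< (n≢0⇒n>0 (x≉y ∘ dist≡0⇒≋)) xy≤n)
      where open ≋-Reasoning

  Far : ℕ → ℕ → ℕ → Set
  Far c x y = c ≤ dist x y × c ≤ dist y x

  module _ {c p} (n≡c+c+p : n ≡ c + c + p) where

    private
      dist+dist≡c+p+c : ¬ x ≋ y → dist x y + dist y x ≡ c + p + c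
      dist+dist≡c+p+c x≉y = trans (dist+dist≡n x≉y) (trans n≡c+c+p (xy∙z≈xz∙y c c p))

    Far⇒offset : ¬ x ≋ y → Far c x y → ∃[ k ] k ≤ p × x + (c + k) ≋ y
    Far⇒offset {x} {y} x≉y (c≤xy , c≤yx) = dist x y ∸ c , k≤p , x+[c+k]≋y
      where
      xy≤c+p : dist x y ≤ c + p
      xy≤c+p = +-cancelʳ-≤ c (dist x y) (c + p)
        (≤-trans (+-monoʳ-≤ (dist x y) c≤yx) (≤-reflexive (dist+dist≡c+p+c x≉y)))
      k≤p = m≤n+o⇒m∸n≤o (dist x y) c xy≤c+p
      x+[c+k]≋y = trans (≡⇒≋ (cong (x +_) (m+[n∸m]≡n c≤xy))) (+-dist-≋ x y)

    offset⇒Far : 1 ≤ c → k ≤ p → x + (c + k) ≋ y → Far c x y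
    offset⇒Far {k} {x} {y} 1≤c k≤p x+[c+k]≋y = c≤xy , +-cancelˡ-≤ (c + p) c (dist y x) (begin
      c + p + c              ≡⟨ dist+dist≡c+p+c x≉y ⟨
      dist x y + dist y x    ≤⟨ +-monoˡ-≤ (dist y x) xy≤c+p ⟩
      c + p + dist y x       ∎)
      where
      open ≤-Reasoning
      c+k<n : c + k < n
      c+k<n = begin-strict
        c + k                ≤⟨ +-monoʳ-≤ c k≤p ⟩
        c + p                <⟨ m<m+n (c + p) 1≤c ⟩
        c + p + c            ≡⟨ trans n≡c+c+p (xy∙z≈xz∙y c c p) ⟨
        n                    ∎
      xy≡c+k = dist-unique x+[c+k]≋y c+k<n
      c≤xy = subst (c ≤_) (sym xy≡c+k) (m≤m+n c k)
      xy≤c+p = subst (_≤ c + p) (sym xy≡c+k) (+-monoʳ-≤ c k≤p)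
      x≉y : ¬ x ≋ y
      x≉y x≋y = <⇒≱ (≤-trans 1≤c c≤xy) (≤-reflexive (≋⇒dist≡0 x≋y))

  -- Windows: 𝟙[ dist t y < len ] says that y lies in the arc [t, t + len)

  window-¬Far : ∀ {c} → dist t x < c → dist t y < c → ¬ Far c x y
  window-¬Far {t} {x} {y} {c} tx<c ty<c (c≤xy , c≤yx) with ≤-total (dist t x) (dist t y)
  ... | inj₁ tx≤ty = <⇒≱ (≤-<-trans (dist≤dist-from tx≤ty) ty<c) c≤xy
  ... | inj₂ ty≤tx = <⇒≱ (≤-<-trans (dist≤dist-from ty≤tx) tx<c) c≤yx

  -- x + - (c ∸ 1) is the start of the window of length c that ends at x.
  ¬Far⇒in-window : ∀ {c} → 1 ≤ c → ¬ Far c x y → dist x y < c ⊎ dist (x + - (c ∸ 1)) y < c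
  ¬Far⇒in-window {x} {y} {c} 1≤c x≁y with dist x y <? c | dist y x <? c
  ... | yes xy<c | _        = inj₁ xy<c
  ... | no  xy≮c | no  yx≮c = contradiction (≮⇒≥ xy≮c , ≮⇒≥ yx≮c) x≁y
  ... | no  _    | yes yx<c = inj₂ (≤-<-trans (dist-≤ u+[c-1∸yx]≋y) (≤-<-trans (m∸n≤m c-1 (dist y x)) c-1<c))
    where
    open ≋-Reasoning
    c-1 = c ∸ 1
    u = x + - c-1
    c-1<c : c-1 < c
    c-1<c = ∸-monoʳ-< z<s 1≤c
    yx≤c-1 : dist y x ≤ c-1
    yx≤c-1 = m+n≤o⇒m≤o∸n (dist y x) (subst (_≤ c) (+-comm 1 (dist y x)) yx<c)
    u+[c-1∸yx]≋y : u + (c-1 ∸ dist y x) ≋ y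
    u+[c-1∸yx]≋y = +-cancelʳ-≋ _ y (dist y x) (begin
      u + (c-1 ∸ dist y x) + dist y x   ≡⟨ trans (+-assoc u _ (dist y x)) (cong (u +_) (m∸n+n≡m yx≤c-1)) ⟩
      u + c-1                           ≈⟨ x-k+k≋x x c-1 ⟩
      x                                 ≈⟨ +-dist-≋ y x ⟨
      y + dist y x                      ∎)

  window-split : ∀ {a b} x y → a + b ≤ n →
                 𝟙[ dist x y < a + b ] ≡ 𝟙[ dist x y < a ] + 𝟙[ dist (x + a) y < b ]
  window-split {a} {b} x y a+b≤n with a ≤? dist x y | a + b ≤? dist x y
  ... | no a≰xy | _ =
    trans (𝟙-yes (<-≤-trans xy<a (m≤m+n a b))) (sym (cong₂ _+_ (𝟙-yes xy<a) (𝟙-no b≤[x+a]y)))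
    where
    open ≤-Reasoning
    xy<a = ≰⇒> a≰xy
    a≤n = m+n≤o⇒m≤o a a+b≤n
    b≤[x+a]y : b ≤ dist (x + a) y
    b≤[x+a]y = begin
      b                    ≤⟨ m+n≤o⇒m≤o∸n b (subst (_≤ n) (+-comm a b) a+b≤n) ⟩
      n ∸ a                ≤⟨ m≤n+m (n ∸ a) (dist x y) ⟩
      dist x y + (n ∸ a)   ≡⟨ dist-+ˡ-wrap xy<a a≤n ⟨
      dist (x + a) y       ∎
  ... | yes a≤xy | no a+b≰xy =
    trans (𝟙-yes (≰⇒> a+b≰xy)) (sym (cong₂ _+_ (𝟙-no a≤xy) (𝟙-yes [x+a]y<b)))
    where
    [x+a]y<b : dist (x + a) y < b
    [x+a]y<b = subst₂ _<_ (sym (dist-+ˡ a≤xy)) (m+n∸m≡n a b) (∸-monoˡ-< (≰⇒> a+b≰xy) a≤xy)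
  ... | yes a≤xy | yes a+b≤xy =
    trans (𝟙-no a+b≤xy) (sym (cong₂ _+_ (𝟙-no a≤xy) (𝟙-no b≤[x+a]y)))
    where
    b≤[x+a]y : b ≤ dist (x + a) y
    b≤[x+a]y = subst (b ≤_) (sym (dist-+ˡ a≤xy))
                     (m+n≤o⇒m≤o∸n b (subst (_≤ dist x y) (+-comm a b) a+b≤xy))

  -- Matchings of far pairs on the cycle

  record FarMatching (c m : ℕ) : Set where
    field
      point    : Fin m → Bool → ℕ
      far      : ∀ i → Far c (point i true) (point i false)
      distinct : ∀ {i j} → i ≢ j → ∀ b b′ → ¬ point i b ≋ point j b′
      near     : ∀ {i j} → i ≢ j → ∀ b b′ → ¬ Far c (point i b) (point j b′)

  module Counting {c p q} (n≡c+c+p : n ≡ c + c + p) (1≤c : 1 ≤ c) (M : FarMatching c q) where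
    open FarMatching M

    pairCount : ℕ → ℕ → Fin q → ℕ
    pairCount t len j = 𝟙[ dist t (point j true) < len ] + 𝟙[ dist t (point j false) < len ]

    count : ℕ → ℕ → ℕ
    count t len = ∑[ j < q ] pairCount t len j

    endpoint≤pairCount : ∀ {t len} j b → 𝟙[ dist t (point j b) < len ] ≤ pairCount t len j
    endpoint≤pairCount j true  = m≤m+n _ _
    endpoint≤pairCount j false = m≤n+m _ _

    count-congˡ : ∀ {t t′} len → t ≋ t′ → count t len ≡ count t′ len
    count-congˡ {t} {t′} len t≋t′ = sum-cong-≗ {x = pairCount t len} {y = pairCount t′ len} λ j →
      cong₂ _+_ (cong 𝟙[_< len ] (dist-congˡ t≋t′)) (cong 𝟙[_< len ] (dist-congˡ t≋t′))

    pairCount≤1 : ∀ t i → pairCount t c i ≤ 1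
    pairCount≤1 t i = 𝟙-pair≤1 λ (in-window , in-window′) → window-¬Far in-window in-window′ (far i)

    pairCount-at-point : ∀ i b j → 1 ≤ pairCount (point i b) c j
    pairCount-at-point i b j with j Fin.≟ i
    ... | yes refl = subst (_≤ pairCount (point i b) c j) (𝟙-yes (subst (_< c) (sym (≋⇒dist≡0 refl)) 1≤c))
                           (endpoint≤pairCount j b)
    ... | no j≢i = +-cancelʳ-≤ 1 1 (pairCount xᵢ c j) (begin
      2                                         ≤⟨ +-mono-≤ (covered true) (covered false) ⟩
      (A true + B true) + (A false + B false)   ≡⟨ interchange (A true) (B true) (A false) (B false) ⟩
      pairCount xᵢ c j + pairCount u c j        ≤⟨ +-monoʳ-≤ (pairCount xᵢ c j) (pairCount≤1 u j) ⟩
      pairCount xᵢ c j + 1                      ∎)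
      where
      open ≤-Reasoning
      xᵢ = point i b
      u = xᵢ + - (c ∸ 1)
      A B : Bool → ℕ
      A b′ = 𝟙[ dist xᵢ (point j b′) < c ]
      B b′ = 𝟙[ dist u (point j b′) < c ]
      covered : ∀ b′ → 1 ≤ A b′ + B b′
      covered b′ with ¬Far⇒in-window 1≤c (near (j≢i ∘ sym) b b′)
      ... | inj₁ in-xᵢ = subst (_≤ A b′ + B b′) (𝟙-yes in-xᵢ) (m≤m+n _ _)
      ... | inj₂ in-u  = subst (_≤ A b′ + B b′) (𝟙-yes in-u) (m≤n+m _ _)

    q≤count-at-point : ∀ {t} i b → t ≋ point i b → q ≤ count t c
    q≤count-at-point {t} i b t≋x = begin
      q                     ≡⟨ trans (sym (*-identityʳ q)) (sym (∑-const q 1)) ⟩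
      ∑[ j < q ] 1          ≤⟨ ∑-mono-≤ (pairCount-at-point i b) ⟩
      count (point i b) c   ≡⟨ count-congˡ c t≋x ⟨
      count t c             ∎
      where open ≤-Reasoning

    pairCount-suc : ∀ {t} j → (∀ b → ¬ t ≋ point j b) → pairCount t c j ≤ pairCount (suc t) c j
    pairCount-suc j t-free = +-mono-≤ (𝟙-antitone {b = c} (dist-suc-≤ (t-free true)))
                                      (𝟙-antitone {b = c} (dist-suc-≤ (t-free false)))

    count-suc : ∀ {t} → (∀ j b → ¬ t ≋ point j b) → count t c ≤ count (suc t) c
    count-suc t-free = ∑-mono-≤ λ j → pairCount-suc j (t-free j)

    count-suc-at-point : ∀ {t} i b → t ≋ point i b → count t c ≤ suc (count (suc t) c)
    count-suc-at-point i b t≋x = ∑-mono-≤-except i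
      (λ j j≢i → pairCount-suc j λ b′ t≋y → distinct j≢i b′ b (trans (sym t≋y) t≋x))
      (≤-trans (pairCount≤1 _ i) (m≤m+n 1 _))

    occupied? : ∀ t → Dec (∃[ i ] (t ≋ point i true ⊎ t ≋ point i false))
    occupied? t = Fin.any? λ i → (t % n ≟ point i true % n) ⊎-dec (t % n ≟ point i false % n)

    q≤suc-count : Fin q → ∀ t → q ≤ suc (count t c)
    q≤suc-count i₀ t = subst (λ s → q ≤ suc s) (count-congˡ c x₀+d≋t) (walk (dist x₀ t))
      where
      x₀ = point i₀ true
      x₀+d≋t : dist x₀ t + x₀ ≋ t
      x₀+d≋t = trans (≡⇒≋ (+-comm (dist x₀ t) x₀)) (+-dist-≋ x₀ t)
      walk : ∀ d → q ≤ suc (count (d + x₀) c)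
      walk zero    = m≤n⇒m≤1+n (q≤count-at-point i₀ true refl)
      walk (suc d) with occupied? (d + x₀)
      ... | yes (i , inj₁ t≋x) = ≤-trans (q≤count-at-point i true t≋x) (count-suc-at-point i true t≋x)
      ... | yes (i , inj₂ t≋x) = ≤-trans (q≤count-at-point i false t≋x) (count-suc-at-point i false t≋x)
      ... | no  t-free = ≤-trans (walk d) (s≤s (count-suc λ where
              j true  t≋x → t-free (j , inj₁ t≋x)
              j false t≋x → t-free (j , inj₂ t≋x)))

    count-full : ∀ t → count t n ≡ q + q
    count-full t = begin
      count t n      ≡⟨ sum-cong-≗ {x = pairCount t n} {y = λ _ → 2} (λ j →
                          cong₂ _+_ (𝟙-yes (dist<n t (point j true))) (𝟙-yes (dist<n t (point j false)))) ⟩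
      ∑[ j < q ] 2   ≡⟨ ∑-const q 2 ⟩
      q * 2          ≡⟨ trans (*-suc q 1) (cong (q +_) (*-identityʳ q)) ⟩
      q + q          ∎
      where open ≡-Reasoning

    count-split : ∀ {a b} t → a + b ≤ n → count t (a + b) ≡ count t a + count (t + a) b
    count-split {a} {b} t a+b≤n = trans
      (sum-cong-≗ {x = pairCount t (a + b)} {y = λ j → pairCount t a j + pairCount (t + a) b j} λ j →
        trans (cong₂ _+_ (window-split {a} {b} t (point j true) a+b≤n)
                         (window-split {a} {b} t (point j false) a+b≤n))
              (interchange 𝟙[ dist t (point j true) < a ] _ 𝟙[ dist t (point j false) < a ] _))
      (∑-distrib-+ (pairCount t a) (pairCount (t + a) b))

    count-p≤2 : Fin q → ∀ w → count w p ≤ 2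
    count-p≤2 i₀ w = +-cancelʳ-≤ (q + q) X 2 (begin
      X + (q + q)                       ≤⟨ +-monoʳ-≤ X (+-mono-≤ (q≤suc-count i₀ _) (q≤suc-count i₀ _)) ⟩
      X + (suc A + suc B)               ≡⟨ cong (λ s → X + suc s) (+-suc A B) ⟩
      X + (2 + (A + B))                 ≡⟨ x∙yz≈y∙xz X 2 (A + B) ⟩
      2 + (X + (A + B))                 ≡⟨ cong (λ s → 2 + (X + s)) (count-split {c} {c} (w + p) c+c≤n) ⟨
      2 + (X + count (w + p) (c + c))   ≡⟨ cong (2 +_) (count-split {p} {c + c} w p+[c+c]≤n) ⟨
      2 + count w (p + (c + c))         ≡⟨ cong (λ len → 2 + count w len) n≡p+[c+c] ⟨
      2 + count w n                     ≡⟨ cong (2 +_) (count-full w) ⟩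
      2 + (q + q)                       ∎)
      where
      open ≤-Reasoning
      X = count w p
      A = count (w + p) c
      B = count (w + p + c) c
      n≡p+[c+c] : n ≡ p + (c + c)
      n≡p+[c+c] = trans n≡c+c+p (+-comm (c + c) p)
      p+[c+c]≤n = ≤-reflexive (sym n≡p+[c+c])
      c+c≤n = ≤-trans (m≤n+m (c + c) p) p+[c+c]≤n

    module Tiling .{{_ : NonZero p}} (x₀ : ℕ) (n<qp : n < q * p) where

      p≤n : p ≤ n
      p≤n = subst (p ≤_) (sym n≡c+c+p) (m≤n+m p (c + c))

      tile : Fin q → ℕ
      tile k = x₀ + toℕ k * p

      coverage : ℕ → ℕ
      coverage y = ∑[ k < q ] 𝟙[ dist (tile k) y < p ]

      tile-index : ∀ d → d < q * p → Fin q
      tile-index d d<qp = fromℕ< (m<n*o⇒m/o<n d<qp)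

      in-tile : ∀ {d y} (d<qp : d < q * p) → x₀ + d ≋ y → 𝟙[ dist (tile (tile-index d d<qp)) y < p ] ≡ 1
      in-tile {d} {y} d<qp x₀+d≋y =
        𝟙-yes (subst (_< p) (sym (dist-unique tile+d%p≋y (<-≤-trans (m%n<n d p) p≤n))) (m%n<n d p))
        where
        open ≋-Reasoning
        tile+d%p≋y : tile (tile-index d d<qp) + d % p ≋ y
        tile+d%p≋y = begin
          x₀ + toℕ (tile-index d d<qp) * p + d % p
            ≡⟨ cong (λ k → x₀ + k * p + d % p) (Fin.toℕ-fromℕ< (m<n*o⇒m/o<n d<qp)) ⟩
          x₀ + d / p * p + d % p
            ≡⟨ trans (+-assoc x₀ _ _) (cong (x₀ +_) (+-comm (d / p * p) _)) ⟩
          x₀ + (d % p + d / p * p)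
            ≡⟨ cong (x₀ +_) (m≡m%n+[m/n]*n d p) ⟨
          x₀ + d
            ≈⟨ x₀+d≋y ⟩
          y ∎

      1≤coverage : ∀ y → 1 ≤ coverage y
      1≤coverage y = subst (_≤ coverage y) (in-tile d<qp (+-dist-≋ x₀ y))
                           (term≤∑ (λ k → 𝟙[ dist (tile k) y < p ]) (tile-index _ d<qp))
        where d<qp = <-trans (dist<n x₀ y) n<qp

      2≤coverage-x₀ : 2 ≤ coverage x₀
      2≤coverage-x₀ = subst (_≤ coverage x₀)
        (cong₂ _+_ (in-tile 0<qp (≡⇒≋ (+-identityʳ x₀))) (in-tile n<qp (+n-≋ x₀)))
        (two-terms≤∑ (λ k → 𝟙[ dist (tile k) x₀ < p ]) first≢second)
        where
        0<qp = ≤-<-trans z≤n n<qp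
        first≢second : tile-index 0 0<qp ≢ tile-index n n<qp
        first≢second first≡second = <⇒≢ (m≥n⇒m/n>0 p≤n) (begin
          0                         ≡⟨ 0/n≡0 p ⟨
          0 / p                     ≡⟨ Fin.toℕ-fromℕ< _ ⟨
          toℕ (tile-index 0 0<qp)   ≡⟨ cong toℕ first≡second ⟩
          toℕ (tile-index n n<qp)   ≡⟨ Fin.toℕ-fromℕ< _ ⟩
          n / p                     ∎)
          where open ≡-Reasoning

  no-far-matching : ∀ {c p q} → n ≡ c + c + p → 1 ≤ c → n < q * p → ¬ FarMatching c q
  no-far-matching {c} {p} {suc q} n≡c+c+p 1≤c n<qp M =
    <⇒≱ (<-≤-trans coverage-lower-bound (≤-reflexive (sym tiles≡coverage))) tiles-upper-bound
    where
    open FarMatching M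
    open Counting n≡c+c+p 1≤c M
    open ≤-Reasoning
    instance
      p≢0 : NonZero p
      p≢0 = ≢-nonZero λ p≡0 → n≮0 (subst (n <_) (trans (cong (suc q *_) p≡0) (*-zeroʳ (suc q))) n<qp)
    open Tiling (point zero true) n<qp

    coverages : Fin (suc q) → ℕ
    coverages j = coverage (point j true) + coverage (point j false)

    tiles-upper-bound : ∑[ k < suc q ] count (tile k) p ≤ suc q * 2
    tiles-upper-bound = begin
      ∑[ k < suc q ] count (tile k) p   ≤⟨ ∑-mono-≤ (count-p≤2 zero ∘ tile) ⟩
      ∑[ k < suc q ] 2                  ≡⟨ ∑-const (suc q) 2 ⟩
      suc q * 2                         ∎

    tiles≡coverage : ∑[ k < suc q ] count (tile k) p ≡ ∑[ j < suc q ] coverages j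
    tiles≡coverage = begin-equality
      ∑[ k < suc q ] ∑[ j < suc q ] pairCount (tile k) p j
        ≡⟨ ∑-comm (λ k j → pairCount (tile k) p j) ⟩
      ∑[ j < suc q ] ∑[ k < suc q ] pairCount (tile k) p j
        ≡⟨ sum-cong-≗ {y = coverages} (λ j → ∑-distrib-+ (λ k → 𝟙[ dist (tile k) (point j true) < p ])
                                                          (λ k → 𝟙[ dist (tile k) (point j false) < p ])) ⟩
      ∑[ j < suc q ] coverages j
        ∎

    coverage-lower-bound : suc q * 2 < ∑[ j < suc q ] coverages j
    coverage-lower-bound = +-mono-≤ (+-mono-≤ 2≤coverage-x₀ (1≤coverage _)) (begin
      q * 2                          ≡⟨ ∑-const q 2 ⟨
      ∑[ j < q ] 2                   ≤⟨ ∑-mono-≤ {g = coverages ∘ suc} (λ j →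
                                          +-mono-≤ (1≤coverage _) (1≤coverage _)) ⟩
      ∑[ j < q ] coverages (suc j)   ∎)

  -- G_{q,p} as a graph of far pairs on the cycle

  module Relabelling {q p c} (n≡c+c+p : n ≡ c + c + p) (q*p≡n+2 : q * p ≡ n + 2)
                     (q*[c+p]≋1 : q * (c + p) ≋ 1) (1≤c : 1 ≤ c) where

    relabel : ℕ → ℕ
    relabel x = x * (c + p)

    q*relabel≋id : ∀ x → q * relabel x ≋ x
    q*relabel≋id x = begin
      q * (x * (c + p))   ≡⟨ x*[y*z]≡y*[x*z] q x (c + p) ⟩
      x * (q * (c + p))   ≈⟨ *-congˡ-≋ x q*[c+p]≋1 ⟩
      x * 1               ≡⟨ *-identityʳ x ⟩
      x                   ∎
      where open ≋-Reasoning

    relabel-cancel : relabel x ≋ relabel y → x ≋ y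
    relabel-cancel {x} {y} rx≋ry = begin
      x               ≈⟨ q*relabel≋id x ⟨
      q * relabel x   ≈⟨ *-congˡ-≋ q rx≋ry ⟩
      q * relabel y   ≈⟨ q*relabel≋id y ⟩
      y               ∎
      where open ≋-Reasoning

    relabel-injective : ∀ {u v : Fin n} → relabel (toℕ u) ≋ relabel (toℕ v) → u ≡ v
    relabel-injective {u} {v} ru≋rv =
      Fin.toℕ-injective (≋⇒≡ (Fin.toℕ<n u) (Fin.toℕ<n v) (relabel-cancel ru≋rv))

    relabel-step : y + 1 ≋ x + q * k → relabel x + (c + k) ≋ relabel y
    relabel-step {y} {x} {k} y+1≋x+qk = begin
      relabel x + (c + k)                 ≡⟨ trans (cong (relabel x +_) (+-comm c k)) (sym (+-assoc _ k c)) ⟩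
      relabel x + k + c                   ≡⟨ cong (λ r → relabel x + r + c) (*-identityʳ k) ⟨
      relabel x + k * 1 + c               ≈⟨ +-congʳ-≋ {y = c} (+-congˡ-≋ {x = relabel x}
                                                                      (*-congˡ-≋ k q*[c+p]≋1)) ⟨
      relabel x + k * (q * (c + p)) + c   ≡⟨ cong (_+ c) (distrib x q k (c + p)) ⟨
      (x + q * k) * (c + p) + c           ≈⟨ +-congʳ-≋ {y = c} (*-congʳ-≋ (c + p) y+1≋x+qk) ⟨
      (y + 1) * (c + p) + c               ≡⟨ cong (_+ c) (*-distribʳ-+ (c + p) y 1) ⟩
      relabel y + 1 * (c + p) + c         ≡⟨ cong (λ r → relabel y + r + c) (*-identityˡ (c + p)) ⟩
      relabel y + (c + p) + c             ≡⟨ trans (+-assoc (relabel y) (c + p) c) (cong (relabel y +_) c+p+c≡n) ⟩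
      relabel y + n                       ≈⟨ +n-≋ (relabel y) ⟩
      relabel y                           ∎
      where
      open ≋-Reasoning
      distrib : ∀ x q k m → (x + q * k) * m ≡ x * m + k * (q * m)
      distrib = solve-∀
      c+p+c≡n : c + p + c ≡ n
      c+p+c≡n = trans (xy∙z≈xz∙y c p c) (sym n≡c+c+p)

    relabel-step⁻¹ : relabel x + (c + k) ≋ relabel y → y + 1 ≋ x + q * k
    relabel-step⁻¹ {x} {k} {y} rx+[c+k]≋ry = begin
      y + 1       ≈⟨ +-congʳ-≋ {y = 1} (relabel-cancel (trans (sym rx+[c+k]≋ry) (relabel-step v+1≋x+qk))) ⟩
      v + 1       ≈⟨ v+1≋x+qk ⟩
      x + q * k   ∎
      where
      open ≋-Reasoning
      v = x + q * k + - 1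
      v+1≋x+qk = x-k+k≋x (x + q * k) 1

    1≤q : 1 ≤ q
    1≤q = n≢0⇒n>0 λ q≡0 → m+1+n≢0 n (trans (sym q*p≡n+2) (cong (_* p) q≡0))

    x+q*p≋x+1+1 : ∀ x → x + q * p ≋ x + 1 + 1
    x+q*p≋x+1+1 x = begin
      x + q * p     ≡⟨ cong (x +_) q*p≡n+2 ⟩
      x + (n + 2)   ≡⟨ trans (cong (x +_) (+-comm n 2)) (sym (+-assoc x 2 n)) ⟩
      x + 2 + n     ≈⟨ +n-≋ (x + 2) ⟩
      x + 2         ≡⟨ +-assoc x 1 1 ⟨
      x + 1 + 1     ∎
      where open ≋-Reasoning

    x+[n∸1]+1≋x+q*0 : ∀ x → x + (n ∸ 1) + 1 ≋ x + q * 0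
    x+[n∸1]+1≋x+q*0 x = begin
      x + (n ∸ 1) + 1   ≡⟨ trans (+-assoc x _ 1) (cong (x +_) (m∸n+n≡m (>-nonZero⁻¹ n))) ⟩
      x + n             ≈⟨ +n-≋ x ⟩
      x                 ≡⟨ trans (sym (+-identityʳ x)) (cong (x +_) (sym (*-zeroʳ q))) ⟩
      x + q * 0         ∎
      where open ≋-Reasoning

    x+q*k∸1+1≡x+q*k : ∀ x → 1 ≤ k → x + q * k ∸ 1 + 1 ≡ x + q * k
    x+q*k∸1+1≡x+q*k {k} x 1≤k = m∸n+n≡m (≤-trans (*-mono-≤ 1≤q 1≤k) (m≤n+m (q * k) x))

    -- The neighbours i + 1 and i − 1 are the cases k = p and k = 0 of i + qk − 1, as qp ≡ 2 (mod n).

    InNbhd⇒step : ∀ {u v} → InNbhd n q p u v → ∃[ k ] k ≤ p × toℕ v + 1 ≋ toℕ u + q * k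
    InNbhd⇒step {u} (_ , inj₁ v≡u+1) =
      p , ≤-refl , trans (+-congʳ-≋ {y = 1} (≡%⇒≋ v≡u+1)) (sym (x+q*p≋x+1+1 (toℕ u)))
    InNbhd⇒step {u} (_ , inj₂ (inj₁ v≡u-1)) =
      0 , z≤n , trans (+-congʳ-≋ {y = 1} (≡%⇒≋ v≡u-1)) (x+[n∸1]+1≋x+q*0 (toℕ u))
    InNbhd⇒step {u} (_ , inj₂ (inj₂ (k , 1≤k , k≤p-1 , v≡u+qk-1))) =
      k , ≤-trans k≤p-1 (m∸n≤m p 1) ,
      trans (+-congʳ-≋ {y = 1} (≡%⇒≋ v≡u+qk-1)) (≡⇒≋ (x+q*k∸1+1≡x+q*k (toℕ u) 1≤k))

    step⇒InNbhd : ∀ {u v k} → u ≢ v → k ≤ p → toℕ v + 1 ≋ toℕ u + q * k → InNbhd n q p u v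
    step⇒InNbhd {u} {v} {k} u≢v k≤p v+1≋u+qk with k ≟ 0 | k ≟ p
    ... | yes refl | _        =
      u≢v , inj₂ (inj₁ (+1≋⇒≡% (Fin.toℕ<n v) (trans v+1≋u+qk (sym (x+[n∸1]+1≋x+q*0 (toℕ u))))))
    ... | no _     | yes refl =
      u≢v , inj₁ (+1≋⇒≡% (Fin.toℕ<n v) (trans v+1≋u+qk (x+q*p≋x+1+1 (toℕ u))))
    ... | no k≢0   | no k≢p   =
      u≢v , inj₂ (inj₂ (k , 1≤k , k≤p-1 ,
        +1≋⇒≡% (Fin.toℕ<n v) (trans v+1≋u+qk (≡⇒≋ (sym (x+q*k∸1+1≡x+q*k (toℕ u) 1≤k))))))
      where
      1≤k = n≢0⇒n>0 k≢0
      k≤p-1 = m+n≤o⇒m≤o∸n k (subst (_≤ p) (+-comm 1 k) (≤∧≢⇒< k≤p k≢p))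

    InNbhd⇒Far : ∀ {u v} → InNbhd n q p u v → Far c (relabel (toℕ u)) (relabel (toℕ v))
    InNbhd⇒Far u~v with InNbhd⇒step u~v
    ... | k , k≤p , v+1≋u+qk = offset⇒Far n≡c+c+p 1≤c k≤p (relabel-step v+1≋u+qk)

    Far⇒InNbhd : ∀ {u v} → u ≢ v → Far c (relabel (toℕ u)) (relabel (toℕ v)) → InNbhd n q p u v
    Far⇒InNbhd u≢v far with Far⇒offset n≡c+c+p (u≢v ∘ relabel-injective) far
    ... | k , k≤p , ru+[c+k]≋rv = step⇒InNbhd u≢v k≤p (relabel-step⁻¹ ru+[c+k]≋rv)

    Adj⇒Far : ∀ {u v} → Adj (InNbhd n q p) u v → Far c (relabel (toℕ u)) (relabel (toℕ v))
    Adj⇒Far (inj₁ u~v) = InNbhd⇒Far u~v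
    Adj⇒Far (inj₂ v~u) = swap (InNbhd⇒Far v~u)

    far-matching : ∀ {m} → HasInducedMatching (InNbhd n q p) m → FarMatching c m
    far-matching (e , M) = record
      { point    = λ i b → relabel (toℕ (endpoint e i b))
      ; far      = λ i → Adj⇒Far (proj₁ M i)
      ; distinct = λ i≢j b b′ → proj₁ (cross i≢j b b′) ∘ relabel-injective
      ; near     = λ i≢j b b′ →
                     proj₂ (cross i≢j b b′) ∘ inj₁ ∘ Far⇒InNbhd (proj₁ (cross i≢j b b′))
      }
      where cross = cross-pair {G = InNbhd n q p} M

odd⇒≡3+s*2 : ∀ {q} → 3 ≤ q → q % 2 ≡ 1 → ∃[ s ] q ≡ 3 + s * 2
odd⇒≡3+s*2 {q} 3≤q q%2≡1 with q / 2 | trans (m≡m%n+[m/n]*n q 2) (cong (_+ q / 2 * 2) q%2≡1)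
... | zero  | q≡1     = contradiction (subst (3 ≤_) q≡1 3≤q) λ { (s≤s ()) }
... | suc s | q≡3+s*2 = s , q≡3+s*2

-- Here q = 2(s + 1) + 1 and p = p′ + 1, so the c = sp − 1 of the header is (s + 1)(p′ + 1) − 1.

module CircleParameters (s p′ : ℕ) where
  q = 3 + s * 2
  p = suc p′
  c = s + p′ + s * p′

  q*p≡c+c+p+2 : q * p ≡ c + c + p + 2
  q*p≡c+c+p+2 = identity s p′
    where
    identity : ∀ s p′ → (3 + s * 2) * suc p′ ≡ (s + p′ + s * p′) + (s + p′ + s * p′) + suc p′ + 2
    identity = solve-∀

  q*[c+p]≡1+[2+s]*[c+c+p] : q * (c + p) ≡ 1 + (2 + s) * (c + c + p)
  q*[c+p]≡1+[2+s]*[c+c+p] = identity s p′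
    where
    identity : ∀ s p′ → (3 + s * 2) * ((s + p′ + s * p′) + suc p′)
                        ≡ 1 + (2 + s) * ((s + p′ + s * p′) + (s + p′ + s * p′) + suc p′)
    identity = solve-∀

  order≡c+c+p : order q p ≡ c + c + p
  order≡c+c+p = trans (cong (_∸ 2) q*p≡c+c+p+2) (m+n∸n≡m (c + c + p) 2)

  G-qK₂-free : .{{_ : NonZero (order q p)}} → 1 ≤ c → ¬ HasInducedMatching (GraphG q p) q
  G-qK₂-free 1≤c = no-far-matching order≡c+c+p 1≤c n<q*p ∘ far-matching
    where
    open Cyclic (order q p)
    q*p≡n+2 = trans q*p≡c+c+p+2 (cong (_+ 2) (sym order≡c+c+p))
    n<q*p = subst (order q p <_) (sym q*p≡n+2) (m<m+n (order q p) z<s)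
    q*[c+p]≋1 : q * (c + p) ≋ 1
    q*[c+p]≋1 = trans (≡⇒≋ q*[c+p]≡1+[2+s]*n) (+*n-≋ 1 (2 + s))
      where
      q*[c+p]≡1+[2+s]*n = trans q*[c+p]≡1+[2+s]*[c+c+p] (cong (λ m → 1 + (2 + s) * m) (sym order≡c+c+p))
    open Relabelling {q = q} order≡c+c+p q*p≡n+2 q*[c+p]≋1 1≤c

lemma6 : (q p : ℕ) → 3 ≤ q → q % 2 ≡ 1 → 1 ≤ p →
    .{{_ : NonZero (order q p)}} →
    ¬ HasInducedMatching (GraphG q p) q
lemma6 q (suc p′) 3≤q q-odd (s≤s z≤n) with odd⇒≡3+s*2 3≤q q-odd
lemma6 _ (suc zero)     _ _ _ | zero  , refl = no-induced-matching-on-one-vertex {G = GraphG 3 1}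
lemma6 _ (suc (suc p′)) _ _ _ | zero  , refl = CircleParameters.G-qK₂-free 0 (suc p′) (s≤s z≤n)
lemma6 _ (suc p′)       _ _ _ | suc s , refl = CircleParameters.G-qK₂-free (suc s) p′ (s≤s z≤n)
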